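{- If $G$ and $H$ are connected graphs, then ${\rm gp}(G\boxtimes H) \ge {\rm gp}(G)\,{\rm gp}(H)$.
   Context: All graphs are finite and simple. The strong product $G\boxtimes H$ has vertex set $V(G)\times V(H)$, with distinct $(g,h),(g',h')$ adjacent iff ($g=g'$ or $gg'\in E(G)$) and ($h=h'$ or $hh'\in E(H)$). For a connected graph $X$, a set $S\subseteq V(X)$ is a general position set if no three pairwise distinct vertices of $S$ lie on a common geodesic of $X$; ${\rm gp}(X)$ is the maximum cardinality of a general position set. -}

module Defs where

open import Data.Nat using (ℕ; zero; suc; _*_; _≤_)
open import Data.Fin using (Fin; remQuot)
open import Data.Fin.Subset using (Subset; _∈_; ∣_∣)
open import Data.List using (List; []; _∷_)
import Data.List.Membership.Propositional as LM
open import Data.Product using (Σ; ∃; _×_; _,_; proj₁; proj₂)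
open import Data.Sum using (_⊎_; inj₁; inj₂)
open import Relation.Nullary using (¬_)
open import Relation.Binary.PropositionalEquality using (_≡_; _≢_; refl; sym)

record Graph : Set₁ where
  field
    n      : ℕ
    _~_    : Fin n → Fin n → Set
    irrefl : ∀ x → ¬ (x ~ x)
    sym~   : ∀ {x y} → x ~ y → y ~ x

module _ (G : Graph) where
  open Graph G

  data Walk : Fin n → Fin n → Set where
    [_] : ∀ u → Walk u u
    _∷_ : ∀ {u x v} → u ~ x → Walk x v → Walk u v

  walkLength : ∀ {u v} → Walk u v → ℕ
  walkLength [ _ ]   = zero
  walkLength (_ ∷ w) = suc (walkLength w)

  walkVertices : ∀ {u v} → Walk u v → List (Fin n)
  walkVertices [ u ]            = u ∷ []
  walkVertices (_∷_ {u} _ w)    = u ∷ walkVertices w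

  Connected : Set
  Connected = ∀ u v → Walk u v

  IsGeodesic : ∀ {u v} → Walk u v → Set
  IsGeodesic {u} {v} w = ∀ (w′ : Walk u v) → walkLength w ≤ walkLength w′

  OnCommonGeodesic : Fin n → Fin n → Fin n → Set
  OnCommonGeodesic x y z =
    Σ (Fin n) λ u → Σ (Fin n) λ v → Σ (Walk u v) λ w →
      IsGeodesic w × (LM._∈_ x (walkVertices w))
                   × (LM._∈_ y (walkVertices w))
                   × (LM._∈_ z (walkVertices w))

  IsGPSet : Subset n → Set
  IsGPSet S = ∀ x y z → x ∈ S → y ∈ S → z ∈ S →
    x ≢ y → y ≢ z → x ≢ z → ¬ OnCommonGeodesic x y z

  IsGPNumber : ℕ → Set
  IsGPNumber k = (Σ (Subset n) λ S → IsGPSet S × ∣ S ∣ ≡ k)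
               × (∀ S → IsGPSet S → ∣ S ∣ ≤ k)

-- strong product; vertex set Fin (nG * nH) ≅ Fin nG × Fin nH via remQuot
_⊠_ : Graph → Graph → Graph
G ⊠ H = record
  { n      = G.n * H.n
  ; _~_    = Adj
  ; irrefl = λ x a → proj₁ a refl
  ; sym~   = λ { (ne , p , q) → (λ e → ne (sym e)) , symOr {R = G._~_} G.sym~ p , symOr {R = H._~_} H.sym~ q }
  }
  where
    module G = Graph G
    module H = Graph H
    EqOr : ∀ {m} → (Fin m → Fin m → Set) → Fin m → Fin m → Set
    EqOr R a b = a ≡ b ⊎ R a b
    symOr : ∀ {m} {R : Fin m → Fin m → Set} → (∀ {a b} → R a b → R b a) →
            ∀ {a b} → EqOr R a b → EqOr R b a
    symOr s (inj₁ e) = inj₁ (sym e)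
    symOr s (inj₂ r) = inj₂ (s r)
    Adj : Fin (G.n * H.n) → Fin (G.n * H.n) → Set
    Adj x y = x ≢ y
            × EqOr G._~_ (proj₁ (remQuot {G.n} H.n x)) (proj₁ (remQuot {G.n} H.n y))
            × EqOr H._~_ (proj₂ (remQuot {G.n} H.n x)) (proj₂ (remQuot {G.n} H.n y))

module Submission where

-- If SG and SH are general position sets of G and H, then so is their
-- product SG ⊗ SH in G ⊠ H, which has ∣ SG ∣ · ∣ SH ∣ elements.  Suppose
-- three distinct vertices of SG ⊗ SH lie on a common geodesic; then one of
-- them, q, lies between the other two, p and r: d(p,q) + d(q,r) = d(p,r).
-- Walks in G ⊠ H project to walks of no greater length in both factors, and
-- coordinate walks of length at most k combine to a walk of length at most k
-- in G ⊠ H; so d(p,r) is the larger of the coordinate distances.  In the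
-- factor X realising it, the coordinates of p, q, r satisfy
-- d_X(p,q) + d_X(q,r) ≤ d(p,q) + d(q,r) ≤ d_X(p,r): either they are three
-- distinct vertices of a general position set on a common geodesic of X, or
-- two of them coincide and one of the positive d(p,q), d(q,r) must vanish.
--
-- Geodesics exist only up to
-- double negation here (adjacency is not decidable), which suffices because
-- each use has goal ⊥.

open import Defs
open import Data.Nat using (ℕ; zero; suc; _+_; _*_; _≤_; _<_; z≤n; s≤s; _≤?_)
open import Data.Nat.Properties
  using (≤-refl; ≤-trans; m≤n⇒m≤1+n; ≤-total; ≤-pred; ≰⇒>; <⇒≱; +-mono-≤; +-cancelˡ-≤; +-cancelʳ-≤; m<m+n; m<n+m; m≤m+n)
open import Data.Fin using (Fin; remQuot; combine) renaming (_≟_ to _≟ᶠ_)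
open import Data.Fin.Properties using (remQuot-combine; combine-remQuot; combine-injectiveˡ; combine-injectiveʳ)
open import Data.Fin.Subset using (Subset; ⊥; inside; outside; ∣_∣) renaming (_∈_ to _∈ˢ_)
open import Data.Fin.Subset.Properties using (∣⊥∣≡0)
open import Data.Vec using ([]; _∷_; _++_; lookup; map; concat)
open import Data.Vec.Properties using ([]=⇒lookup; lookup⇒[]=; lookup-concat; lookup-map; lookup-replicate)
open import Data.Bool using (Bool; if_then_else_)
open import Data.List using (List)
open import Data.List.Membership.Propositional using () renaming (_∈_ to _∈ᴸ_)
open import Data.List.Relation.Unary.Any using (here; there)
open import Data.Product using (Σ; _×_; _,_; proj₁; proj₂)
open import Data.Sum using (_⊎_; inj₁; inj₂; [_,_]′) renaming (map₁ to ⊎-map₁)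
open import Data.Empty using () renaming (⊥ to Empty; ⊥-elim to Empty-elim)
open import Function using (_∘_; case_of_)
open import Relation.Nullary using (¬_; yes; no; contradiction)
open import Relation.Binary.PropositionalEquality
  using (_≡_; _≢_; refl; sym; trans; cong; cong₂; subst; subst₂; ≢-sym; module ≡-Reasoning)

ShortWalk : (X : Graph) → Fin (Graph.n X) → Fin (Graph.n X) → ℕ → Set
ShortWalk X u v k = Σ (Walk X u v) λ w → walkLength X w ≤ k

infixr 5 _∷ˢ_
_∷ˢ_ : ∀ {X k u v w} → Graph._~_ X u v → ShortWalk X v w k → ShortWalk X u w (suc k)
e ∷ˢ (w , w≤k) = e ∷ w , s≤s w≤k

module Walks (X : Graph) where
  open Graph X

  private
    len : ∀ {u v} → Walk X u v → ℕ
    len = walkLength X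

    vertices : ∀ {u v} → Walk X u v → List (Fin n)
    vertices = walkVertices X

  adjacent⇒distinct : ∀ {x y} → x ~ y → x ≢ y
  adjacent⇒distinct {x} x~y refl = irrefl x x~y

  infixr 5 _++ʷ_

  _++ʷ_ : ∀ {u v w} → Walk X u v → Walk X v w → Walk X u w
  [ _ ]   ++ʷ q = q
  (e ∷ p) ++ʷ q = e ∷ (p ++ʷ q)

  length-++ʷ : ∀ {u v w} (p : Walk X u v) (q : Walk X v w) → len (p ++ʷ q) ≡ len p + len q
  length-++ʷ [ _ ]   q = refl
  length-++ʷ (e ∷ p) q = cong suc (length-++ʷ p q)

  ++ʷ-assoc : ∀ {s t u v} (p : Walk X s t) (q : Walk X t u) (r : Walk X u v) →
              (p ++ʷ q) ++ʷ r ≡ p ++ʷ (q ++ʷ r)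
  ++ʷ-assoc [ _ ]   q r = refl
  ++ʷ-assoc (e ∷ p) q r = cong (e ∷_) (++ʷ-assoc p q r)

  start∈ : ∀ {u v} (p : Walk X u v) → u ∈ᴸ vertices p
  start∈ [ _ ]   = here refl
  start∈ (e ∷ p) = here refl

  end∈ : ∀ {u v} (p : Walk X u v) → v ∈ᴸ vertices p
  end∈ [ _ ]   = here refl
  end∈ (e ∷ p) = there (end∈ p)

  ∈-++ʷʳ : ∀ {u v w x} (p : Walk X u v) (q : Walk X v w) → x ∈ᴸ vertices q → x ∈ᴸ vertices (p ++ʷ q)
  ∈-++ʷʳ [ _ ]   q x∈q = x∈q
  ∈-++ʷʳ (e ∷ p) q x∈q = there (∈-++ʷʳ p q x∈q)

  ∈-++ʷ⁻ : ∀ {u v w x} (p : Walk X u v) (q : Walk X v w) →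
           x ∈ᴸ vertices (p ++ʷ q) → x ∈ᴸ vertices p ⊎ x ∈ᴸ vertices q
  ∈-++ʷ⁻ [ _ ]   q x∈q          = inj₂ x∈q
  ∈-++ʷ⁻ (e ∷ p) q (here refl)  = inj₁ (here refl)
  ∈-++ʷ⁻ (e ∷ p) q (there x∈pq) = ⊎-map₁ there (∈-++ʷ⁻ p q x∈pq)

  split : ∀ {u v x} (w : Walk X u v) → x ∈ᴸ vertices w →
          Σ (Walk X u x) λ p → Σ (Walk X x v) λ q → w ≡ p ++ʷ q
  split [ u ]   (here refl) = [ u ] , [ u ] , refl
  split {u} (e ∷ w) (here refl) = [ u ] , e ∷ w , refl
  split (e ∷ w) (there x∈w) with split w x∈w
  ... | p , q , refl = e ∷ p , q , refl

  distinct⇒positive : ∀ {u v} (w : Walk X u v) → u ≢ v → 0 < len w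
  distinct⇒positive [ u ]   u≢u = contradiction refl u≢u
  distinct⇒positive (e ∷ w) _   = s≤s z≤n

  geodesic-prefix : ∀ {u v w} (p : Walk X u v) (q : Walk X v w) → IsGeodesic X (p ++ʷ q) → IsGeodesic X p
  geodesic-prefix p q geo p′ = +-cancelʳ-≤ (len q) (len p) (len p′) (begin
    len p + len q     ≡⟨ length-++ʷ p q ⟨
    len (p ++ʷ q)     ≤⟨ geo (p′ ++ʷ q) ⟩
    len (p′ ++ʷ q)    ≡⟨ length-++ʷ p′ q ⟩
    len p′ + len q    ∎)
    where open Data.Nat.Properties.≤-Reasoning

  geodesic-suffix : ∀ {u v w} (p : Walk X u v) (q : Walk X v w) → IsGeodesic X (p ++ʷ q) → IsGeodesic X q
  geodesic-suffix p q geo q′ = +-cancelˡ-≤ (len p) (len q) (len q′) (begin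
    len p + len q     ≡⟨ length-++ʷ p q ⟨
    len (p ++ʷ q)     ≤⟨ geo (p ++ʷ q′) ⟩
    len (p ++ʷ q′)    ≡⟨ length-++ʷ p q′ ⟩
    len p + len q′    ∎)
    where open Data.Nat.Properties.≤-Reasoning

  Between : Fin n → Fin n → Fin n → Set
  Between p q r = Σ (Walk X p q) λ w₁ → Σ (Walk X q r) λ w₂ → IsGeodesic X (w₁ ++ʷ w₂)

  EndOf : Fin n → Fin n → Fin n → Set
  EndOf x y z = Between x y z ⊎ Between x z y

  end-of-geodesic : ∀ {u v y z} (w : Walk X u v) → IsGeodesic X w →
                    y ∈ᴸ vertices w → z ∈ᴸ vertices w → EndOf u y z
  end-of-geodesic w geo y∈w z∈w with split w z∈w
  ... | p , q , refl with ∈-++ʷ⁻ p q y∈w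
  ...   | inj₁ y∈p with split p y∈p
  ...     | p₁ , p₂ , refl = inj₁ (p₁ , p₂ , geodesic-prefix p q geo)
  end-of-geodesic w geo y∈w z∈w | p , q , refl | inj₂ y∈q with split q y∈q
  ...     | q₁ , q₂ , refl =
    inj₂ (p , q₁ , geodesic-prefix (p ++ʷ q₁) q₂ (subst (IsGeodesic X) (sym (++ʷ-assoc p q₁ q₂)) geo))

  -- Among three vertices of a geodesic, the first one along it ends a
  -- geodesic through the other two: either one of them is the start vertex,
  -- or all lie on the geodesic obtained by dropping the first edge.
  three-on-geodesic : ∀ {u v a b c} (w : Walk X u v) → IsGeodesic X w →
    a ∈ᴸ vertices w → b ∈ᴸ vertices w → c ∈ᴸ vertices w →
    EndOf a b c ⊎ EndOf b a c ⊎ EndOf c a b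
  three-on-geodesic w@([ _ ]) geo (here refl) b∈w c∈w = inj₁ (end-of-geodesic w geo b∈w c∈w)
  three-on-geodesic w@(_ ∷ _) geo (here refl) b∈w c∈w = inj₁ (end-of-geodesic w geo b∈w c∈w)
  three-on-geodesic w@(_ ∷ _) geo a∈w@(there _) (here refl) c∈w =
    inj₂ (inj₁ (end-of-geodesic w geo a∈w c∈w))
  three-on-geodesic w@(_ ∷ _) geo a∈w@(there _) b∈w@(there _) (here refl) =
    inj₂ (inj₂ (end-of-geodesic w geo a∈w b∈w))
  three-on-geodesic (e ∷ w) geo (there a∈w) (there b∈w) (there c∈w) =
    three-on-geodesic w (geodesic-suffix (e ∷ [ _ ]) w geo) a∈w b∈w c∈w

  gp-from-betweenness : (S : Subset n) →
    (∀ {p q r} → p ∈ˢ S → q ∈ˢ S → r ∈ˢ S → p ≢ q → q ≢ r → ¬ Between p q r) →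
    IsGPSet X S
  gp-from-betweenness S notBetween x y z x∈S y∈S z∈S x≢y y≢z x≢z (_ , _ , w , geo , x∈w , y∈w , z∈w)
    with three-on-geodesic w geo x∈w y∈w z∈w
  ... | inj₁ (inj₁ xyz)        = notBetween x∈S y∈S z∈S x≢y y≢z xyz
  ... | inj₁ (inj₂ xzy)        = notBetween x∈S z∈S y∈S x≢z (≢-sym y≢z) xzy
  ... | inj₂ (inj₁ (inj₁ yxz)) = notBetween y∈S x∈S z∈S (≢-sym x≢y) x≢z yxz
  ... | inj₂ (inj₁ (inj₂ yzx)) = notBetween y∈S z∈S x∈S y≢z (≢-sym x≢z) yzx
  ... | inj₂ (inj₂ (inj₁ zxy)) = notBetween z∈S x∈S y∈S (≢-sym x≢z) x≢y zxy
  ... | inj₂ (inj₂ (inj₂ zyx)) = notBetween z∈S y∈S x∈S (≢-sym y≢z) (≢-sym x≢y) zyx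

  -- Adjacency is not decidable, so constructively we only get this up to
  -- double negation; the argument is induction on a bound for the length.
  geodesic-exists : ∀ {u v} → Walk X u v → ¬ ¬ Σ (Walk X u v) (IsGeodesic X)
  geodesic-exists w = shorten (len w) w ≤-refl
    where
    shorten : ∀ {u v} k (w : Walk X u v) → len w ≤ k → ¬ ¬ Σ (Walk X u v) (IsGeodesic X)
    shorten k w w≤k noGeodesic = noGeodesic (w , shortest)
      where
      shortest : IsGeodesic X w
      shortest w′ with len w ≤? len w′
      ... | yes w≤w′ = w≤w′
      ... | no  w≰w′ = Empty-elim (shorter k (≰⇒> w≰w′) w≤k)
        where
        shorter : ∀ k → len w′ < len w → len w ≤ k → Empty
        shorter zero    w′<w w≤0 = <⇒≱ (≤-trans w′<w w≤0) z≤n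
        shorter (suc k) w′<w w≤k = shorten k w′ (≤-pred (≤-trans w′<w w≤k)) noGeodesic

  -- In a general position set S, no vertex m can be reached from s and lead
  -- on to t by walks of positive length bounds L₁, L₂ with L₁ + L₂ ≤ d(s,t):
  -- either s, m, t are distinct and lie on the geodesic formed by the two
  -- walks, or two of them coincide and one of the bounds must vanish.
  no-short-detour : (S : Subset n) → IsGPSet X S → ∀ {s m t L₁ L₂} →
    s ∈ˢ S → m ∈ˢ S → t ∈ˢ S → ShortWalk X s m L₁ → ShortWalk X m t L₂ →
    (g : Walk X s t) → IsGeodesic X g → L₁ + L₂ ≤ len g → 0 < L₁ → 0 < L₂ → Empty
  no-short-detour S gp {s} {m} {t} {L₁} {L₂} s∈S m∈S t∈S (w₁ , w₁≤L₁) (w₂ , w₂≤L₂) g geo L≤g 0<L₁ 0<L₂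
    with s ≟ᶠ m | m ≟ᶠ t | s ≟ᶠ t
  -- s = m forces L₁ + L₂ ≤ d(s,t) ≤ L₂; m = t forces L₁ + L₂ ≤ L₁; s = t forces L₁ + L₂ ≤ 0
  ... | yes refl | _ | _ = <⇒≱ (m<n+m L₂ 0<L₁) (≤-trans L≤g (≤-trans (geo w₂) w₂≤L₂))
  ... | no _ | yes refl | _ = <⇒≱ (m<m+n L₁ 0<L₂) (≤-trans L≤g (≤-trans (geo w₁) w₁≤L₁))
  ... | no _ | no _ | yes refl = <⇒≱ (≤-trans 0<L₁ (m≤m+n L₁ L₂)) (≤-trans L≤g (geo [ s ]))
  ... | no s≢m | no m≢t | no s≢t =
    gp s m t s∈S m∈S t∈S s≢m m≢t s≢t
      (s , t , w₁ ++ʷ w₂ , detour-geodesic , start∈ (w₁ ++ʷ w₂) , ∈-++ʷʳ w₁ w₂ (start∈ w₂) , end∈ (w₁ ++ʷ w₂))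
    where
    detour-geodesic : IsGeodesic X (w₁ ++ʷ w₂)
    detour-geodesic w′ = begin
      len (w₁ ++ʷ w₂)    ≡⟨ length-++ʷ w₁ w₂ ⟩
      len w₁ + len w₂    ≤⟨ +-mono-≤ w₁≤L₁ w₂≤L₂ ⟩
      L₁ + L₂            ≤⟨ L≤g ⟩
      len g              ≤⟨ geo w′ ⟩
      len w′             ∎
      where open Data.Nat.Properties.≤-Reasoning

image-walk : (X Y : Graph) (f : Fin (Graph.n X) → Fin (Graph.n Y)) →
  (∀ {x y} → Graph._~_ X x y → f x ≡ f y ⊎ Graph._~_ Y (f x) (f y)) →
  ∀ {u v} (w : Walk X u v) → ShortWalk Y (f u) (f v) (walkLength X w)
image-walk X Y f edge [ u ] = [ f u ] , z≤n
image-walk X Y f edge {v = v} (e ∷ w) with edge e | image-walk X Y f edge w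
... | inj₁ fx≡fy | w′ , w′≤w =
  subst (λ a → ShortWalk Y a (f v) (suc (walkLength X w))) (sym fx≡fy) (w′ , m≤n⇒m≤1+n w′≤w)
... | inj₂ e′    | w′        = e′ ∷ˢ w′

-- The product S ⊗ U of subsets, indexed like Fin (m * n) ≅ Fin m × Fin n
-- via combine: its row i is U when i ∈ S, and empty otherwise.
row : ∀ {n} → Subset n → Bool → Subset n
row U b = if b then U else ⊥

infixr 7 _⊗_
_⊗_ : ∀ {m n} → Subset m → Subset n → Subset (m * n)
S ⊗ U = concat (map (row U) S)

∈-⊗⁻ : ∀ {m n} (S : Subset m) (U : Subset n) i j → combine i j ∈ˢ S ⊗ U → i ∈ˢ S × j ∈ˢ U
∈-⊗⁻ S U i j ij∈S⊗U = lookup⇒[]= i S (proj₁ both) , lookup⇒[]= j U (proj₂ both)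
  where
  inside-if : ∀ b → lookup (row U b) j ≡ inside → b ≡ inside × lookup U j ≡ inside
  inside-if inside  Uj≡inside = refl , Uj≡inside
  inside-if outside ⊥j≡inside = contradiction (trans (sym (lookup-replicate j outside)) ⊥j≡inside) λ ()

  both : lookup S i ≡ inside × lookup U j ≡ inside
  both = inside-if (lookup S i) (begin
    lookup (row U (lookup S i)) j        ≡⟨ cong (λ V → lookup V j) (lookup-map i (row U) S) ⟨
    lookup (lookup (map (row U) S) i) j  ≡⟨ lookup-concat (map (row U) S) i j ⟨
    lookup (S ⊗ U) (combine i j)         ≡⟨ []=⇒lookup ij∈S⊗U ⟩
    inside                               ∎)
    where open ≡-Reasoning

∣++∣ : ∀ {m n} (S : Subset m) (U : Subset n) → ∣ S ++ U ∣ ≡ ∣ S ∣ + ∣ U ∣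
∣++∣ []            U = refl
∣++∣ (inside ∷ S)  U = cong suc (∣++∣ S U)
∣++∣ (outside ∷ S) U = ∣++∣ S U

∣⊗∣ : ∀ {m n} (S : Subset m) (U : Subset n) → ∣ S ⊗ U ∣ ≡ ∣ S ∣ * ∣ U ∣
∣⊗∣ []            U = refl
∣⊗∣ (inside ∷ S)  U = trans (∣++∣ U (S ⊗ U)) (cong (∣ U ∣ +_) (∣⊗∣ S U))
∣⊗∣ {n = n} (outside ∷ S) U = trans (∣++∣ (⊥ {n = n}) (S ⊗ U)) (cong₂ _+_ (∣⊥∣≡0 n) (∣⊗∣ S U))

module StrongProduct (G H : Graph) where
  private
    module G = Graph G
    module H = Graph H
    module WG = Walks G
    module WH = Walks H
    module WP = Walks (G ⊠ H)

  π₁ : Fin (G.n * H.n) → Fin G.n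
  π₁ x = proj₁ (remQuot {G.n} H.n x)

  π₂ : Fin (G.n * H.n) → Fin H.n
  π₂ x = proj₂ (remQuot {G.n} H.n x)

  π₁-combine : ∀ i j → π₁ (combine i j) ≡ i
  π₁-combine i j = cong proj₁ (remQuot-combine {G.n} {H.n} i j)

  π₂-combine : ∀ i j → π₂ (combine i j) ≡ j
  π₂-combine i j = cong proj₂ (remQuot-combine {G.n} {H.n} i j)

  project₁ : ∀ {u v} (w : Walk (G ⊠ H) u v) → ShortWalk G (π₁ u) (π₁ v) (walkLength (G ⊠ H) w)
  project₁ = image-walk (G ⊠ H) G π₁ (proj₁ ∘ proj₂)

  project₂ : ∀ {u v} (w : Walk (G ⊠ H) u v) → ShortWalk H (π₂ u) (π₂ v) (walkLength (G ⊠ H) w)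
  project₂ = image-walk (G ⊠ H) H π₂ (proj₂ ∘ proj₂)

  product-edge : ∀ {i j x y} → i ≢ x ⊎ j ≢ y → i ≡ x ⊎ i G.~ x → j ≡ y ⊎ j H.~ y →
                 Graph._~_ (G ⊠ H) (combine i j) (combine x y)
  product-edge {i} {j} {x} {y} differ i≈x j≈y =
      [ (λ i≢x → i≢x ∘ combine-injectiveˡ i j x y) , (λ j≢y → j≢y ∘ combine-injectiveʳ i j x y) ]′ differ
    , subst₂ (λ a b → a ≡ b ⊎ a G.~ b) (sym (π₁-combine i j)) (sym (π₁-combine x y)) i≈x
    , subst₂ (λ a b → a ≡ b ⊎ a H.~ b) (sym (π₂-combine i j)) (sym (π₂-combine x y)) j≈y

  -- Walking both coordinates at once (a coordinate whose walk has ended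
  -- stays put) gives a walk of G ⊠ H as long as the longer coordinate walk.
  combine-walks : ∀ {i i′ j j′ k} (g : Walk G i i′) (h : Walk H j j′) →
    walkLength G g ≤ k → walkLength H h ≤ k → ShortWalk (G ⊠ H) (combine i j) (combine i′ j′) k
  combine-walks [ i ]   [ j ]   _         _         = [ combine i j ] , z≤n
  combine-walks (e ∷ g) [ j ]   (s≤s g≤k) _         =
    product-edge (inj₁ (WG.adjacent⇒distinct e)) (inj₂ e) (inj₁ refl) ∷ˢ combine-walks g [ j ] g≤k z≤n
  combine-walks [ i ]   (f ∷ h) _         (s≤s h≤k) =
    product-edge (inj₂ (WH.adjacent⇒distinct f)) (inj₁ refl) (inj₂ f) ∷ˢ combine-walks [ i ] h z≤n h≤k
  combine-walks (e ∷ g) (f ∷ h) (s≤s g≤k) (s≤s h≤k) =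
    product-edge (inj₁ (WG.adjacent⇒distinct e)) (inj₂ e) (inj₂ f) ∷ˢ combine-walks g h g≤k h≤k

  walk-from-coordinates : ∀ {x y k} (g : Walk G (π₁ x) (π₁ y)) (h : Walk H (π₂ x) (π₂ y)) →
    walkLength G g ≤ k → walkLength H h ≤ k → ShortWalk (G ⊠ H) x y k
  walk-from-coordinates {x} {y} {k} g h g≤k h≤k =
    subst₂ (λ a b → ShortWalk (G ⊠ H) a b k)
      (combine-remQuot {G.n} H.n x) (combine-remQuot {G.n} H.n y) (combine-walks g h g≤k h≤k)

  -- If SG, SH are in general position, no vertex with coordinates in SG, SH
  -- lies between two others of this kind distinct from it: the factor with
  -- the larger coordinate distance between the outer vertices would contain
  -- a short detour.
  product-not-between : Connected G → Connected H →
    (SG : Subset G.n) (SH : Subset H.n) → IsGPSet G SG → IsGPSet H SH →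
    ∀ {p q r} → (π₁ p ∈ˢ SG × π₂ p ∈ˢ SH) → (π₁ q ∈ˢ SG × π₂ q ∈ˢ SH) → (π₁ r ∈ˢ SG × π₂ r ∈ˢ SH) →
    p ≢ q → q ≢ r → ¬ WP.Between p q r
  product-not-between connG connH SG SH gpG gpH {p} {q} {r}
    (p₁∈ , p₂∈) (q₁∈ , q₂∈) (r₁∈ , r₂∈) p≢q q≢r (w₁ , w₂ , geo) =
    WG.geodesic-exists (connG (π₁ p) (π₁ r)) λ (g , geo-g) →
    WH.geodesic-exists (connH (π₂ p) (π₂ r)) λ (h , geo-h) →
    case ≤-total (walkLength H h) (walkLength G g) of λ where
      (inj₁ h≤g) → WG.no-short-detour SG gpG p₁∈ q₁∈ r₁∈ (project₁ w₁) (project₁ w₂)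
                     g geo-g (detour≤ g h ≤-refl h≤g) 0<L₁ 0<L₂
      (inj₂ g≤h) → WH.no-short-detour SH gpH p₂∈ q₂∈ r₂∈ (project₂ w₁) (project₂ w₂)
                     h geo-h (detour≤ g h g≤h ≤-refl) 0<L₁ 0<L₂
    where
    L₁ L₂ : ℕ
    L₁ = walkLength (G ⊠ H) w₁
    L₂ = walkLength (G ⊠ H) w₂

    0<L₁ : 0 < L₁
    0<L₁ = WP.distinct⇒positive w₁ p≢q

    0<L₂ : 0 < L₂
    0<L₂ = WP.distinct⇒positive w₂ q≢r

    detour≤ : ∀ {k} (g : Walk G (π₁ p) (π₁ r)) (h : Walk H (π₂ p) (π₂ r)) →
              walkLength G g ≤ k → walkLength H h ≤ k → L₁ + L₂ ≤ k
    detour≤ {k} g h g≤k h≤k = begin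
      L₁ + L₂                             ≡⟨ WP.length-++ʷ w₁ w₂ ⟨
      walkLength (G ⊠ H) (w₁ WP.++ʷ w₂)   ≤⟨ geo (proj₁ direct) ⟩
      walkLength (G ⊠ H) (proj₁ direct)   ≤⟨ proj₂ direct ⟩
      k                                   ∎
      where
      open Data.Nat.Properties.≤-Reasoning
      direct : ShortWalk (G ⊠ H) p r k
      direct = walk-from-coordinates g h g≤k h≤k

  coordinates-in : ∀ {SG : Subset G.n} {SH : Subset H.n} {x} → x ∈ˢ SG ⊗ SH → π₁ x ∈ˢ SG × π₂ x ∈ˢ SH
  coordinates-in {SG} {SH} {x} x∈ =
    ∈-⊗⁻ SG SH (π₁ x) (π₂ x) (subst (_∈ˢ SG ⊗ SH) (sym (combine-remQuot {G.n} H.n x)) x∈)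

  ⊗-gp : Connected G → Connected H → (SG : Subset G.n) (SH : Subset H.n) →
         IsGPSet G SG → IsGPSet H SH → IsGPSet (G ⊠ H) (SG ⊗ SH)
  ⊗-gp connG connH SG SH gpG gpH = WP.gp-from-betweenness (SG ⊗ SH) λ p∈ q∈ r∈ →
    product-not-between connG connH SG SH gpG gpH (coordinates-in p∈) (coordinates-in q∈) (coordinates-in r∈)

theorem4p2 : (G H : Graph) → Connected G → Connected H →
    ∀ (a b c : ℕ) → IsGPNumber G a → IsGPNumber H b → IsGPNumber (G ⊠ H) c →
    a * b ≤ c
theorem4p2 G H connG connH _ _ c ((SG , gpG , refl) , _) ((SH , gpH , refl) , _) (_ , maximal) =
  subst (_≤ c) (∣⊗∣ SG SH) (maximal (SG ⊗ SH) (⊗-gp connG connH SG SH gpG gpH))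
  where open StrongProduct G H
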